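{- Let $r,n\ge1$ be integers, $c,d\in\mathbb{Z}$, $B_{c,d}$ the $r\times r$ matrix with diagonal entries $c$ and off-diagonal entries $d$, $\mathscr{d}_1=\gcd(c-d,n)$ and $\mathscr{d}_2=\gcd(c+(r-1)d,n)$. The smallest positive integer $A$ such that $B_{c,d}\boldsymbol{x}\equiv A\cdot\boldsymbol{1}_r\pmod n$ has a solution $\boldsymbol{x}\in(\mathbb{Z}/n\mathbb{Z})^r$ is \[A=\gcd\left(\mathscr{d}_2,\frac{dn}{\mathscr{d}_1}\right).\]
   Context: $\boldsymbol{1}_r$ denotes the $r\times1$ column vector with all entries $1$. -}

module Defs where

open import Data.Nat as ℕ using (ℕ; zero; suc)
open import Data.Integer using (ℤ; +_; _+_; _-_; _*_; 0ℤ)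
open import Data.Integer.DivMod using (_/_)
open import Data.Integer.GCD using (gcd)
open import Data.Fin using (Fin; zero; suc)
open import Data.Fin.Properties using (_≟_)
open import Relation.Nullary using (yes; no)

∑ : (r : ℕ) → (Fin r → ℤ) → ℤ
∑ zero    f = 0ℤ
∑ (suc r) f = f zero + ∑ r (λ i → f (suc i))

B : (r : ℕ) → ℤ → ℤ → Fin r → Fin r → ℤ
B r c d i j with i ≟ j
... | yes _ = c
... | no  _ = d

mulVec : (r : ℕ) → (Fin r → Fin r → ℤ) → (Fin r → ℤ) → Fin r → ℤ
mulVec r M x i = ∑ r (λ j → M i j * x j)

-- Exact integer division a / k (k is a divisor of a in our use);
-- division by 0 returns 0 (never used, since k = gcd(c-d,n) ≥ 1 when n ≥ 1).
_/′_ : ℤ → ℤ → ℤ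
a /′ (+ zero)  = 0ℤ
a /′ (+ suc k) = a / (+ suc k)
a /′ k@(ℤ.negsuc _) = a / k

𝒹₁ : ℤ → ℤ → ℕ → ℤ
𝒹₁ c d n = gcd (c - d) (+ n)

𝒹₂ : ℕ → ℤ → ℤ → ℕ → ℤ
𝒹₂ r c d n = gcd (c + (+ (r ℕ.∸ 1)) * d) (+ n)

-- The system B_{c,d} x ≡ A·1_r (mod n) has a solution x ∈ (ℤ/nℤ)^r
-- (x represented by integer lifts; the congruence is divisibility by n).
open import Data.Integer.Divisibility using (_∣_)
open import Data.Product using (∃)

Solvable : (r : ℕ) → ℤ → ℤ → ℕ → ℤ → Set
Solvable r c d n A =
  ∃ λ (x : Fin r → ℤ) → ∀ (i : Fin r) → (+ n) ∣ (mulVec r (B r c d) x i - A)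

-- Write e = c - d and f = c + (r-1)d. Row i of B x is e·x_i + d·Σx, so two rows differ by
-- e·(x_i - x_j); modulo n this forces every x_i - x_0 into m·ℤ, where m = n / gcd(e,n), and
-- then row 0 equals f·x_0 + d·Σ(x_i - x_0), a multiple of gcd(gcd(f,n), d·m) = gcd(𝒹₂, dn/𝒹₁).
-- Conversely, Bézout writes that gcd as u·(a f + b n) + v·d m, and the vector with all
-- entries u a, except u a + m v in position 0, attains it, because n divides e·m.
module Submission where

open import Defs
open import Data.Nat using (ℕ; _≥_; _≤_)
open import Data.Integer using (ℤ; +_; _*_)
open import Data.Integer.GCD using (gcd)
open import Data.Product using (_×_)
open import Relation.Binary.PropositionalEquality using (_≡_)

import Data.Nat as ℕ
import Data.Nat.Properties as ℕ
import Data.Nat.Divisibility as ℕ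
import Data.Nat.GCD as ℕ
open import Data.Integer
  using (_+_; _-_; -_; 0ℤ; ∣_∣; +[1+_]; -[1+_]; _/_; _%_; NonZero; ≢-nonZero)
open import Data.Integer.Properties
  using (pos-+; pos-*; -1*i≡-i; *-identityˡ; *-zeroʳ; *-assoc; *-comm; *-distribˡ-+;
         +-identityˡ; *-cancelʳ-≡; +-injective)
open import Data.Integer.DivMod using (a≡a%n+[a/n]*n; n%d<d)
open import Data.Integer.GCD using (gcd[i,j]∣i; gcd[i,j]∣j; gcd[i,j]≡0⇒j≡0)
open import Data.Integer.Divisibility.Signed
  using (_∣_; divides; ∣ᵤ⇒∣; ∣⇒∣ᵤ; ∣-refl; ∣-trans; ∣m∣n⇒∣m+n; ∣m∣n⇒∣m-n; ∣m+n∣n⇒∣m;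
         ∣n⇒∣m*n; ∣m⇒∣m*n; *-monoʳ-∣; *-cancelʳ-∣)
open import Data.Integer.Tactic.RingSolver using (solve-∀)
open import Data.Fin using (Fin; zero; suc)
open import Data.Fin.Properties using () renaming (_≟_ to _≟ᶠ_)
open import Data.Product using (∃; ∃₂; _,_)
open import Data.Empty using (⊥-elim)
open import Function using (_∘_)
open import Relation.Nullary using (yes; no)
open import Relation.Binary.PropositionalEquality
  using (refl; sym; trans; cong; cong₂; subst; subst₂; module ≡-Reasoning)
open ≡-Reasoning

∑-cong : ∀ r {f g : Fin r → ℤ} → (∀ i → f i ≡ g i) → ∑ r f ≡ ∑ r g
∑-cong ℕ.zero    f≗g = refl
∑-cong (ℕ.suc r) f≗g = cong₂ _+_ (f≗g zero) (∑-cong r (f≗g ∘ suc))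

∑-distribˡ : ∀ r a (f : Fin r → ℤ) → ∑ r (λ i → a * f i) ≡ a * ∑ r f
∑-distribˡ ℕ.zero    a f = sym (*-zeroʳ a)
∑-distribˡ (ℕ.suc r) a f =
  trans (cong (λ t → a * f zero + t) (∑-distribˡ r a (f ∘ suc))) (sym (*-distribˡ-+ a (f zero) _))

∑-const : ∀ r a → ∑ r (λ _ → a) ≡ + r * a
∑-const ℕ.zero    a = refl
∑-const (ℕ.suc r) a = trans (cong (λ t → a + t) (∑-const r a)) (identity a (+ r))
  where
  identity : ∀ a R → a + R * a ≡ (+ 1 + R) * a
  identity = solve-∀

∑-shift : ∀ r a (f : Fin r → ℤ) → ∑ r f ≡ + r * a + ∑ r (λ i → f i - a)
∑-shift ℕ.zero    a f = refl
∑-shift (ℕ.suc r) a f =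
  trans (cong (λ t → f zero + t) (∑-shift r a (f ∘ suc))) (identity (f zero) (+ r) a _)
  where
  identity : ∀ b R a s → b + (R * a + s) ≡ (+ 1 + R) * a + ((b - a) + s)
  identity = solve-∀

∑-preserves-∣ : ∀ r {k} (f : Fin r → ℤ) → (∀ i → k ∣ f i) → k ∣ ∑ r f
∑-preserves-∣ ℕ.zero    f k∣f = divides 0ℤ refl
∑-preserves-∣ (ℕ.suc r) f k∣f = ∣m∣n⇒∣m+n (k∣f zero) (∑-preserves-∣ r (f ∘ suc) (k∣f ∘ suc))

B-suc : ∀ r c d (i j : Fin r) → B (ℕ.suc r) c d (suc i) (suc j) ≡ B r c d i j
B-suc r c d i j with i ≟ᶠ j
... | yes _ = refl
... | no  _ = refl

mulVec-B : ∀ r c d x (i : Fin r) → mulVec r (B r c d) x i ≡ (c - d) * x i + d * ∑ r x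
mulVec-B (ℕ.suc r) c d x zero = begin
  c * x zero + ∑ r (λ j → d * x (suc j))  ≡⟨ cong (λ t → c * x zero + t) (∑-distribˡ r d (x ∘ suc)) ⟩
  c * x zero + d * ∑ r (x ∘ suc)           ≡⟨ identity c d (x zero) _ ⟩
  (c - d) * x zero + d * ∑ (ℕ.suc r) x     ∎
  where
  identity : ∀ c d a s → c * a + d * s ≡ (c - d) * a + d * (a + s)
  identity = solve-∀
mulVec-B (ℕ.suc r) c d x (suc i) = begin
  d * x zero + ∑ r (λ j → B (ℕ.suc r) c d (suc i) (suc j) * x (suc j))
    ≡⟨ cong (λ t → d * x zero + t) (∑-cong r (λ j → cong (_* x (suc j)) (B-suc r c d i j))) ⟩
  d * x zero + mulVec r (B r c d) (x ∘ suc) i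
    ≡⟨ cong (λ t → d * x zero + t) (mulVec-B r c d (x ∘ suc) i) ⟩
  d * x zero + ((c - d) * x (suc i) + d * ∑ r (x ∘ suc))
    ≡⟨ identity (c - d) d (x zero) (x (suc i)) _ ⟩
  (c - d) * x (suc i) + d * ∑ (ℕ.suc r) x
    ∎
  where
  identity : ∀ e d a b s → d * a + (e * b + d * s) ≡ e * b + d * (a + s)
  identity = solve-∀

mulVec-B-sub : ∀ r c d x (i j : Fin r) →
  mulVec r (B r c d) x i - mulVec r (B r c d) x j ≡ (c - d) * (x i - x j)
mulVec-B-sub r c d x i j = begin
  mulVec r (B r c d) x i - mulVec r (B r c d) x j
    ≡⟨ cong₂ _-_ (mulVec-B r c d x i) (mulVec-B r c d x j) ⟩
  ((c - d) * x i + d * ∑ r x) - ((c - d) * x j + d * ∑ r x)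
    ≡⟨ identity (c - d) (x i) (x j) (d * ∑ r x) ⟩
  (c - d) * (x i - x j)
    ∎
  where
  identity : ∀ e a b t → (e * a + t) - (e * b + t) ≡ e * (a - b)
  identity = solve-∀

∣i∣≡s*i : ∀ i → ∃ λ s → + ∣ i ∣ ≡ s * i
∣i∣≡s*i (+ k)    = + 1 , sym (*-identityˡ (+ k))
∣i∣≡s*i -[1+ k ] = - + 1 , sym (-1*i≡-i -[1+ k ])

pos-lift : ∀ g y b x a → g ℕ.+ y ℕ.* b ≡ x ℕ.* a → + g ≡ + x * + a - + y * + b
pos-lift g y b x a eq = begin
  + g                                 ≡⟨ identity (+ g) (+ y * + b) ⟩
  (+ g + + y * + b) - + y * + b       ≡⟨ cong (λ t → (+ g + t) - + y * + b) (sym (pos-* y b)) ⟩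
  (+ g + + (y ℕ.* b)) - + y * + b     ≡⟨ cong (_- + y * + b) (sym (pos-+ g (y ℕ.* b))) ⟩
  + (g ℕ.+ y ℕ.* b) - + y * + b       ≡⟨ cong (λ t → + t - + y * + b) eq ⟩
  + (x ℕ.* a) - + y * + b             ≡⟨ cong (_- + y * + b) (pos-* x a) ⟩
  + x * + a - + y * + b               ∎
  where
  identity : ∀ g t → g ≡ (g + t) - t
  identity = solve-∀

gcd-bézout : ∀ i j → ∃₂ λ u v → gcd i j ≡ u * i + v * j
gcd-bézout i j with ∣i∣≡s*i i | ∣i∣≡s*i j | ℕ.Bézout.identity (ℕ.gcd-GCD ∣ i ∣ ∣ j ∣)
... | s , ∣i∣≡si | t , ∣j∣≡tj | ℕ.Bézout.+- x y eq =
  + x * s , - (+ y * t) , (begin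
    gcd i j                       ≡⟨ pos-lift _ y (∣ j ∣) x (∣ i ∣) eq ⟩
    + x * + ∣ i ∣ - + y * + ∣ j ∣ ≡⟨ cong₂ (λ a b → + x * a - + y * b) ∣i∣≡si ∣j∣≡tj ⟩
    + x * (s * i) - + y * (t * j) ≡⟨ identity (+ x) (+ y) s t i j ⟩
    + x * s * i + - (+ y * t) * j ∎)
  where
  identity : ∀ x y s t i j → x * (s * i) - y * (t * j) ≡ x * s * i + - (y * t) * j
  identity = solve-∀
... | s , ∣i∣≡si | t , ∣j∣≡tj | ℕ.Bézout.-+ x y eq =
  - (+ x * s) , + y * t , (begin
    gcd i j                       ≡⟨ pos-lift _ x (∣ i ∣) y (∣ j ∣) eq ⟩
    + y * + ∣ j ∣ - + x * + ∣ i ∣ ≡⟨ cong₂ (λ a b → + y * b - + x * a) ∣i∣≡si ∣j∣≡tj ⟩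
    + y * (t * j) - + x * (s * i) ≡⟨ identity (+ x) (+ y) s t i j ⟩
    - (+ x * s) * i + + y * t * j ∎)
  where
  identity : ∀ x y s t i j → y * (t * j) - x * (s * i) ≡ - (x * s) * i + y * t * j
  identity = solve-∀

[i*k]/k≡i : ∀ i k .{{_ : NonZero k}} → (i * k) / k ≡ i
[i*k]/k≡i i k = sym (*-cancelʳ-≡ i q k (begin
  i * k           ≡⟨ a≡a%n+[a/n]*n (i * k) k ⟩
  + ρ + q * k     ≡⟨ cong (λ t → + t + q * k) ρ≡0 ⟩
  0ℤ + q * k      ≡⟨ +-identityˡ (q * k) ⟩
  q * k           ∎))
  where
  q = (i * k) / k
  ρ = (i * k) % k
  k∣ρ : k ∣ + ρ
  k∣ρ = ∣m+n∣n⇒∣m (subst (k ∣_) (a≡a%n+[a/n]*n (i * k) k) (∣n⇒∣m*n i ∣-refl)) (∣n⇒∣m*n q ∣-refl)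
  ρ≡0 : ρ ≡ 0
  ρ≡0 with ρ | k∣ρ | n%d<d (i * k) k
  ... | ℕ.zero  | _   | _   = refl
  ... | ℕ.suc _ | k∣ρ | ρ<k = ⊥-elim (ℕ.>⇒∤ ρ<k (∣⇒∣ᵤ k∣ρ))

[i*[m*k]]/′k≡i*m : ∀ i m k .{{_ : NonZero k}} → (i * (m * k)) /′ k ≡ i * m
[i*[m*k]]/′k≡i*m i m k@(+[1+ _ ]) = trans (cong (_/ k) (sym (*-assoc i m k))) ([i*k]/k≡i (i * m) k)
[i*[m*k]]/′k≡i*m i m k@(-[1+ _ ]) = trans (cong (_/ k) (sym (*-assoc i m k))) ([i*k]/k≡i (i * m) k)

gcd[gcd[i,j],k]∣i : ∀ i j k → gcd (gcd i j) k ∣ i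
gcd[gcd[i,j],k]∣i i j k =
  ∣-trans {j = gcd i j} (∣ᵤ⇒∣ (gcd[i,j]∣i (gcd i j) k)) (∣ᵤ⇒∣ (gcd[i,j]∣i i j))

gcd[gcd[i,j],k]∣j : ∀ i j k → gcd (gcd i j) k ∣ j
gcd[gcd[i,j],k]∣j i j k =
  ∣-trans {j = gcd i j} (∣ᵤ⇒∣ (gcd[i,j]∣i (gcd i j) k)) (∣ᵤ⇒∣ (gcd[i,j]∣j i j))

n≡m*gcd⇒n∣e*m : ∀ e n m → n ≡ m * gcd e n → n ∣ e * m
n≡m*gcd⇒n∣e*m e n m n≡m*g =
  subst₂ _∣_ (sym n≡m*g) (*-comm m e) (*-monoʳ-∣ m (∣ᵤ⇒∣ (gcd[i,j]∣i e n)))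

n≡m*gcd⇒[n∣e*z⇒m∣z] : ∀ e n m z .{{_ : NonZero (gcd e n)}} → n ≡ m * gcd e n → n ∣ e * z → m ∣ z
n≡m*gcd⇒[n∣e*z⇒m∣z] e n m z n≡m*g n∣ez with gcd-bézout e n
... | u , v , g≡ue+vn = *-cancelʳ-∣ (gcd e n) (subst (_∣ z * gcd e n) n≡m*g n∣zg)
  where
  n∣zg : n ∣ z * gcd e n
  n∣zg = subst (n ∣_) (trans (identity u v e n z) (cong (z *_) (sym g≡ue+vn)))
           (∣m∣n⇒∣m+n (∣n⇒∣m*n u n∣ez) (∣n⇒∣m*n (v * z) ∣-refl))
    where
    identity : ∀ u v e n z → u * (e * z) + v * z * n ≡ z * (u * e + v * n)
    identity = solve-∀

α+ke₀-solves : ∀ r c d n α k A → + n ∣ (c + + r * d) * α + d * k - A → + n ∣ (c - d) * k →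
  Solvable (ℕ.suc r) c d n A
α+ke₀-solves r c d n α k A n∣offDiag n∣ek = x , λ i → ∣⇒∣ᵤ (n∣row i)
  where
  x : Fin (ℕ.suc r) → ℤ
  x zero    = α + k
  x (suc _) = α
  row≡ : ∀ i → mulVec (ℕ.suc r) (B (ℕ.suc r) c d) x i ≡ (c - d) * x i + d * (α + k + + r * α)
  row≡ i = trans (mulVec-B (ℕ.suc r) c d x i)
                 (cong (λ s → (c - d) * x i + d * (α + k + s)) (∑-const r α))
  n∣row : ∀ i → + n ∣ mulVec (ℕ.suc r) (B (ℕ.suc r) c d) x i - A
  n∣row zero =
    subst (+ n ∣_) (sym (trans (cong (_- A) (row≡ zero)) (identity c d (+ r) α k A)))
          (∣m∣n⇒∣m+n n∣offDiag n∣ek)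
    where
    identity : ∀ c d R α k A →
      (c - d) * (α + k) + d * (α + k + R * α) - A ≡ ((c + R * d) * α + d * k - A) + (c - d) * k
    identity = solve-∀
  n∣row (suc i) =
    subst (+ n ∣_) (sym (trans (cong (_- A) (row≡ (suc i))) (identity c d (+ r) α k A))) n∣offDiag
    where
    identity : ∀ c d R α k A →
      (c - d) * α + d * (α + k + R * α) - A ≡ (c + R * d) * α + d * k - A
    identity = solve-∀

solvable-gcd : ∀ r c d n m → + n ∣ (c - d) * m →
  Solvable (ℕ.suc r) c d n (gcd (𝒹₂ (ℕ.suc r) c d n) (d * m))
solvable-gcd r c d n m n∣em
  with gcd-bézout (𝒹₂ (ℕ.suc r) c d n) (d * m) | gcd-bézout (c + + r * d) (+ n)
... | u , v , G≡ | a , b , 𝒹₂≡ =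
  α+ke₀-solves r c d n (u * a) (m * v) _
    (subst (+ n ∣_) (sym offDiag≡) (∣n⇒∣m*n (- (u * b)) ∣-refl))
    (subst (+ n ∣_) (*-assoc (c - d) m v) (∣m⇒∣m*n v n∣em))
  where
  offDiag≡ : (c + + r * d) * (u * a) + d * (m * v) - gcd (𝒹₂ (ℕ.suc r) c d n) (d * m)
           ≡ - (u * b) * + n
  offDiag≡ = trans (cong (λ t → (c + + r * d) * (u * a) + d * (m * v) - t)
                         (trans G≡ (cong (λ t → u * t + v * (d * m)) 𝒹₂≡)))
                   (identity (c + + r * d) d u v a b m (+ n))
    where
    identity : ∀ f d u v a b m n →
      f * (u * a) + d * (m * v) - (u * (a * f + b * n) + v * (d * m)) ≡ - (u * b) * n
    identity = solve-∀

gcd∣solvable : ∀ r c d n m A → (∀ z → + n ∣ (c - d) * z → m ∣ z) → Solvable (ℕ.suc r) c d n A →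
  gcd (𝒹₂ (ℕ.suc r) c d n) (d * m) ∣ A
gcd∣solvable r c d n m A cancel (x , sol) =
  subst (G ∣_) (identity (Bx zero) A) (∣m∣n⇒∣m-n G∣row₀ (∣-trans G∣n (n∣row zero)))
  where
  G = gcd (𝒹₂ (ℕ.suc r) c d n) (d * m)
  Bx = mulVec (ℕ.suc r) (B (ℕ.suc r) c d) x
  y : Fin (ℕ.suc r) → ℤ
  y i = x i - x zero
  n∣row : ∀ i → + n ∣ Bx i - A
  n∣row i = ∣ᵤ⇒∣ (sol i)
  m∣y : ∀ i → m ∣ y i
  m∣y i = cancel (y i)
    (subst (+ n ∣_) (trans (identity′ (Bx i) (Bx zero) A) (mulVec-B-sub (ℕ.suc r) c d x i zero))
           (∣m∣n⇒∣m-n (n∣row i) (n∣row zero)))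
    where
    identity′ : ∀ a b A → (a - A) - (b - A) ≡ a - b
    identity′ = solve-∀
  G∣n : G ∣ + n
  G∣n = gcd[gcd[i,j],k]∣j (c + + r * d) (+ n) (d * m)
  G∣f : G ∣ c + + r * d
  G∣f = gcd[gcd[i,j],k]∣i (c + + r * d) (+ n) (d * m)
  G∣dm : G ∣ d * m
  G∣dm = ∣ᵤ⇒∣ (gcd[i,j]∣j (𝒹₂ (ℕ.suc r) c d n) (d * m))
  row₀≡ : Bx zero ≡ (c + + r * d) * x zero + d * ∑ (ℕ.suc r) y
  row₀≡ = trans (mulVec-B (ℕ.suc r) c d x zero)
            (trans (cong (λ s → (c - d) * x zero + d * s) (∑-shift (ℕ.suc r) (x zero) x))
                   (identity″ c d (+ r) (x zero) (∑ (ℕ.suc r) y)))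
    where
    identity″ : ∀ c d R a s → (c - d) * a + d * ((+ 1 + R) * a + s) ≡ (c + R * d) * a + d * s
    identity″ = solve-∀
  G∣row₀ : G ∣ Bx zero
  G∣row₀ = subst (G ∣_) (sym row₀≡)
    (∣m∣n⇒∣m+n (∣m⇒∣m*n (x zero) G∣f)
               (∣-trans G∣dm (*-monoʳ-∣ d (∑-preserves-∣ (ℕ.suc r) y m∣y))))
  identity : ∀ a A → a - (a - A) ≡ A
  identity = solve-∀

proposition4p6 : (r n : ℕ) → r ≥ 1 → n ≥ 1 → (c d : ℤ) → (A : ℕ) →
    + A ≡ gcd (𝒹₂ r c d n) ((d * + n) /′ 𝒹₁ c d n) →
    (A ≥ 1 × Solvable r c d n (+ A) ×
      ((A′ : ℕ) → A′ ≥ 1 → Solvable r c d n (+ A′) → A ≤ A′))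
proposition4p6 (ℕ.suc r) n@(ℕ.suc _) _ _ c d A A≡ with ∣ᵤ⇒∣ (gcd[i,j]∣j (c - d) (+ n))
... | divides m n≡m*𝒹₁ = A≥1 , solvable , minimal
  where
  instance
    𝒹₁≢0 : NonZero (𝒹₁ c d n)
    𝒹₁≢0 = ≢-nonZero (ℕ.1+n≢0 ∘ +-injective ∘ gcd[i,j]≡0⇒j≡0 {c - d})
  A≡G : + A ≡ gcd (𝒹₂ (ℕ.suc r) c d n) (d * m)
  A≡G = trans (trans A≡ (cong (λ t → gcd (𝒹₂ (ℕ.suc r) c d n) ((d * t) /′ 𝒹₁ c d n)) n≡m*𝒹₁))
              (cong (gcd (𝒹₂ (ℕ.suc r) c d n)) ([i*[m*k]]/′k≡i*m d m (𝒹₁ c d n)))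
  solvable : Solvable (ℕ.suc r) c d n (+ A)
  solvable = subst (Solvable (ℕ.suc r) c d n) (sym A≡G)
    (solvable-gcd r c d n m (n≡m*gcd⇒n∣e*m (c - d) (+ n) m n≡m*𝒹₁))
  A∣ : ∀ {A′} → Solvable (ℕ.suc r) c d n (+ A′) → A ℕ.∣ A′
  A∣ {A′} sol = ∣⇒∣ᵤ (subst (_∣ + A′) (sym A≡G)
    (gcd∣solvable r c d n m (+ A′) (λ z → n≡m*gcd⇒[n∣e*z⇒m∣z] (c - d) (+ n) m z n≡m*𝒹₁) sol))
  A∣n : A ℕ.∣ n
  A∣n = ∣⇒∣ᵤ (subst (_∣ + n) (sym A≡G) (gcd[gcd[i,j],k]∣j (c + + r * d) (+ n) (d * m)))
  A≥1 : A ≥ 1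
  A≥1 = ℕ.n≢0⇒n>0 (λ A≡0 → ℕ.1+n≢0 (ℕ.0∣⇒≡0 (subst (ℕ._∣ n) A≡0 A∣n)))
  minimal : (A′ : ℕ) → A′ ≥ 1 → Solvable (ℕ.suc r) c d n (+ A′) → A ≤ A′
  minimal (ℕ.suc _) _ sol = ℕ.∣⇒≤ (A∣ sol)
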